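{- Let $n$ be divisible by $3$ and $r=n/3$. Let $(C,\overline C)$ be an equitable partition of the $n$-cube $Q_n$ with quotient matrix $\begin{pmatrix}0&3r\\ r&2r\end{pmatrix}$, where $\overline C=\{0,1\}^n\setminus C$. Then $\overline C$ can be split as a disjoint union $\overline C=C_1\cup C_2$ such that $(C,C_1,C_2)$ is an equitable partition of $Q_n$ with quotient matrix $\begin{pmatrix}0&r&2r\\ r&0&2r\\ r&r&r\end{pmatrix}$.
   Context: $Q_n$ is the graph on $\{0,1\}^n$ in which two words are adjacent iff they differ in exactly one position. A partition $(C_i)_{i\in I}$ of the vertex set of a graph $\Gamma$ is an equitable partition with quotient matrix $(S_{i,j})_{i,j\in I}$ if for all $i,j\in I$ and every vertex $c\in C_i$, the number of neighbours of $c$ lying in $C_j$ equals $S_{i,j}$. -}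

module Defs where

open import Data.Nat using (ℕ; zero; suc; _+_; _*_)
open import Data.Bool using (Bool; true; false; if_then_else_)
open import Data.Fin using (Fin; zero; suc)
open import Data.Vec using (Vec; []; _∷_)
open import Data.List using (List; []; _∷_; map; _++_; filter; length)
open import Data.Product using (_×_)
open import Relation.Nullary.Decidable using (_×-dec_)
open import Relation.Binary.PropositionalEquality using (_≡_)
import Data.Nat.Properties as ℕP
import Data.Fin.Properties as FinP

allWords : (n : ℕ) → List (Vec Bool n)
allWords zero = [] ∷ []
allWords (suc n) = map (false ∷_) (allWords n) ++ map (true ∷_) (allWords n)

hamming : {n : ℕ} → Vec Bool n → Vec Bool n → ℕ
hamming [] [] = 0
hamming (false ∷ x) (false ∷ y) = hamming x y
hamming (true ∷ x) (true ∷ y) = hamming x y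
hamming (false ∷ x) (true ∷ y) = suc (hamming x y)
hamming (true ∷ x) (false ∷ y) = suc (hamming x y)

Adjacent : {n : ℕ} → Vec Bool n → Vec Bool n → Set
Adjacent x y = hamming x y ≡ 1

-- A partition of the vertex set of Q_n into classes indexed by Fin k is
-- given by the class-assignment map  col : {0,1}^n → Fin k  (C_i = col⁻¹(i)).
-- Number of neighbours of x lying in class j:
nbrsIn : {n k : ℕ} → (Vec Bool n → Fin k) → Vec Bool n → Fin k → ℕ
nbrsIn {n} col x j =
  length (filter (λ y → (hamming x y ℕP.≟ 1) ×-dec (col y FinP.≟ j)) (allWords n))

IsEquitable : {n k : ℕ} → (Vec Bool n → Fin k) → (Fin k → Fin k → ℕ) → Set
IsEquitable {n} col S = (x : Vec Bool n) (j : _) → nbrsIn col x j ≡ S (col x) j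

twoCol : {n : ℕ} → (Vec Bool n → Bool) → Vec Bool n → Fin 2
twoCol C x = if C x then zero else suc zero

-- Three-class partition (C, C1, C2) where C2 = complement of C minus C1.
threeCol : {n : ℕ} → (Vec Bool n → Bool) → (Vec Bool n → Bool) → Vec Bool n → Fin 3
threeCol C C1 x = if C x then zero else (if C1 x then suc zero else suc (suc zero))

S2 : ℕ → Fin 2 → Fin 2 → ℕ
S2 r zero zero = 0
S2 r zero (suc zero) = 3 * r
S2 r (suc zero) zero = r
S2 r (suc zero) (suc zero) = 2 * r

S3 : ℕ → Fin 3 → Fin 3 → ℕ
S3 r zero zero = 0
S3 r zero (suc zero) = r
S3 r zero (suc (suc zero)) = 2 * r
S3 r (suc zero) zero = r
S3 r (suc zero) (suc zero) = 0
S3 r (suc zero) (suc (suc zero)) = 2 * r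
S3 r (suc (suc zero)) zero = r
S3 r (suc (suc zero)) (suc zero) = r
S3 r (suc (suc zero)) (suc (suc zero)) = r

-- Flipping the first coordinate is an automorphism of Q_n moving every vertex to a
-- neighbour. Since no two vertices of C are adjacent, the translate C₁ of C by this flip
-- lies in the complement of C, and a vertex has as many neighbours in C₁ as its flip has
-- in C. Reading off the quotient matrix of (C, C̄) at x and at its flip gives the first two
-- columns of the new quotient matrix; the third is what remains of the C̄-neighbours.
module Submission where

open import Defs
open import Data.Nat using (ℕ; zero; suc; _+_; _*_)
open import Data.Nat.Properties using (+-suc; +-comm; +-identityʳ; +-cancelˡ-≡; _≟_)
open import Data.Bool using (Bool; true; false; not; _∧_; if_then_else_)
open import Data.Bool.Properties using (∧-assoc)
open import Data.Vec using (Vec; []; _∷_)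
open import Data.Fin using (Fin; zero; suc)
import Data.Fin.Properties as Fin
open import Data.List using (List; []; _∷_; map; _++_; filter; length)
open import Data.List.Membership.Propositional using (_∈_)
open import Data.List.Membership.Propositional.Properties using (∈-map⁺; ∈-++⁺ˡ; ∈-++⁺ʳ)
open import Data.List.Relation.Unary.Any using (here; there)
open import Data.Product using (Σ; _×_; _,_; proj₁; proj₂)
open import Function using (_∘_)
open import Relation.Nullary using (does)
open import Relation.Unary using (Decidable)
open import Relation.Nullary.Decidable using (_×-dec_)
open import Relation.Binary.PropositionalEquality
  using (_≡_; _≗_; refl; sym; trans; cong; cong₂; subst; module ≡-Reasoning)

private
  variable
    A B : Set
    m n k : ℕ

count : (A → Bool) → List A → ℕ
count p []       = 0
count p (x ∷ xs) = if p x then suc (count p xs) else count p xs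

length-filter≡count : {P : A → Set} (P? : Decidable P) (xs : List A) →
                      length (filter P? xs) ≡ count (does ∘ P?) xs
length-filter≡count P? []       = refl
length-filter≡count P? (x ∷ xs) with does (P? x)
... | true  = cong suc (length-filter≡count P? xs)
... | false = length-filter≡count P? xs

count-cong : {p q : A → Bool} → p ≗ q → (xs : List A) → count p xs ≡ count q xs
count-cong p≗q []       = refl
count-cong p≗q (x ∷ xs) rewrite p≗q x = cong (λ c → if _ then suc c else c) (count-cong p≗q xs)

count-++ : (p : A → Bool) (xs ys : List A) → count p (xs ++ ys) ≡ count p xs + count p ys
count-++ p []       ys = refl
count-++ p (x ∷ xs) ys with p x
... | true  = cong suc (count-++ p xs ys)
... | false = count-++ p xs ys

count-map : (p : B → Bool) (f : A → B) (xs : List A) → count p (map f xs) ≡ count (p ∘ f) xs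
count-map p f []       = refl
count-map p f (x ∷ xs) with p (f x)
... | true  = cong suc (count-map p f xs)
... | false = count-map p f xs

count-split : (p q : A → Bool) (xs : List A) →
              count p xs ≡ count (λ y → p y ∧ q y) xs + count (λ y → p y ∧ not (q y)) xs
count-split p q []       = refl
count-split p q (x ∷ xs) with p x | q x
... | true  | true  = cong suc (count-split p q xs)
... | true  | false = trans (cong suc (count-split p q xs)) (sym (+-suc _ _))
... | false | _     = count-split p q xs

count≡0⇒false : {p : A → Bool} {y : A} {xs : List A} → y ∈ xs → count p xs ≡ 0 → p y ≡ false
count≡0⇒false {p = p} {xs = x ∷ xs} (here refl) none with p x
... | false = refl
count≡0⇒false {p = p} {xs = x ∷ xs} (there y∈xs) none with p x
... | false = count≡0⇒false y∈xs none

∈-allWords : (y : Vec Bool n) → y ∈ allWords n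
∈-allWords []                = here refl
∈-allWords {suc n} (false ∷ y) = ∈-++⁺ˡ (∈-map⁺ (false ∷_) (∈-allWords y))
∈-allWords {suc n} (true ∷ y)  = ∈-++⁺ʳ (map (false ∷_) (allWords n)) (∈-map⁺ (true ∷_) (∈-allWords y))

flipHead : Vec Bool (suc m) → Vec Bool (suc m)
flipHead (b ∷ v) = not b ∷ v

hamming-flipHead : (x y : Vec Bool (suc m)) → hamming (flipHead x) (flipHead y) ≡ hamming x y
hamming-flipHead (false ∷ x) (false ∷ y) = refl
hamming-flipHead (false ∷ x) (true ∷ y)  = refl
hamming-flipHead (true ∷ x)  (false ∷ y) = refl
hamming-flipHead (true ∷ x)  (true ∷ y)  = refl

hamming-self : (y : Vec Bool n) → hamming y y ≡ 0
hamming-self []          = refl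
hamming-self (false ∷ y) = hamming-self y
hamming-self (true ∷ y)  = hamming-self y

adjacent-flipHead : (y : Vec Bool (suc m)) → Adjacent y (flipHead y)
adjacent-flipHead (false ∷ y) = cong suc (hamming-self y)
adjacent-flipHead (true ∷ y)  = cong suc (hamming-self y)

count-∘flipHead : (p : Vec Bool (suc m) → Bool) →
                  count (p ∘ flipHead) (allWords (suc m)) ≡ count p (allWords (suc m))
count-∘flipHead {m} p = begin
  count (p ∘ flipHead) (map (false ∷_) W ++ map (true ∷_) W)  ≡⟨ halves (p ∘ flipHead) ⟩
  count (p ∘ (true ∷_)) W + count (p ∘ (false ∷_)) W          ≡⟨ +-comm (count (p ∘ (true ∷_)) W) _ ⟩
  count (p ∘ (false ∷_)) W + count (p ∘ (true ∷_)) W          ≡⟨ halves p ⟨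
  count p (map (false ∷_) W ++ map (true ∷_) W)               ∎
  where
  open ≡-Reasoning
  W = allWords m
  halves : (q : Vec Bool (suc m) → Bool) →
           count q (map (false ∷_) W ++ map (true ∷_) W) ≡ count (q ∘ (false ∷_)) W + count (q ∘ (true ∷_)) W
  halves q = trans (count-++ q (map (false ∷_) W) (map (true ∷_) W))
                   (cong₂ _+_ (count-map q (false ∷_) W) (count-map q (true ∷_) W))

isAdjacent : Vec Bool n → Vec Bool n → Bool
isAdjacent x y = does (hamming x y ≟ 1)

neighboursIn : Vec Bool n → (Vec Bool n → Bool) → ℕ
neighboursIn {n} x D = count (λ y → isAdjacent x y ∧ D y) (allWords n)

nbrsIn≡neighboursIn : (col : Vec Bool n → Fin k) (j : Fin k) {D : Vec Bool n → Bool} →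
                      (∀ y → does (col y Fin.≟ j) ≡ D y) → ∀ x → nbrsIn col x j ≡ neighboursIn x D
nbrsIn≡neighboursIn {n} col j class≗D x =
  trans (length-filter≡count (λ y → (hamming x y ≟ 1) ×-dec (col y Fin.≟ j)) (allWords n))
        (count-cong (λ y → cong (isAdjacent x y ∧_) (class≗D y)) (allWords n))

neighboursIn-split : (D E : Vec Bool n → Bool) (x : Vec Bool n) →
                     neighboursIn x D ≡ neighboursIn x (λ y → D y ∧ E y) + neighboursIn x (λ y → D y ∧ not (E y))
neighboursIn-split {n} D E x = begin
  neighboursIn x D
    ≡⟨ count-split _ E (allWords n) ⟩
  count (λ y → (isAdjacent x y ∧ D y) ∧ E y) (allWords n)
    + count (λ y → (isAdjacent x y ∧ D y) ∧ not (E y)) (allWords n)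
    ≡⟨ cong₂ _+_ (count-cong (λ y → ∧-assoc (isAdjacent x y) (D y) (E y)) (allWords n))
                 (count-cong (λ y → ∧-assoc (isAdjacent x y) (D y) (not (E y))) (allWords n)) ⟩
  neighboursIn x (λ y → D y ∧ E y) + neighboursIn x (λ y → D y ∧ not (E y))  ∎
  where open ≡-Reasoning

neighboursIn-∘flipHead : (D : Vec Bool (suc m) → Bool) (x : Vec Bool (suc m)) →
                         neighboursIn x (D ∘ flipHead) ≡ neighboursIn (flipHead x) D
neighboursIn-∘flipHead {m} D x = begin
  count (λ y → isAdjacent x y ∧ D (flipHead y)) (allWords (suc m))
    ≡⟨ count-cong moved (allWords (suc m)) ⟩
  count (λ y → isAdjacent (flipHead x) (flipHead y) ∧ D (flipHead y)) (allWords (suc m))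
    ≡⟨ count-∘flipHead (λ z → isAdjacent (flipHead x) z ∧ D z) ⟩
  neighboursIn (flipHead x) D  ∎
  where
  open ≡-Reasoning
  moved : ∀ y → isAdjacent x y ∧ D (flipHead y) ≡ isAdjacent (flipHead x) (flipHead y) ∧ D (flipHead y)
  moved y = cong (λ h → does (h ≟ 1) ∧ D (flipHead y)) (sym (hamming-flipHead x y))

neighboursIn≡0⇒false : {D : Vec Bool n → Bool} {x y : Vec Bool n} →
                       Adjacent x y → neighboursIn x D ≡ 0 → D y ≡ false
neighboursIn≡0⇒false {D = D} {x} {y} adj none =
  subst (λ h → does (h ≟ 1) ∧ D y ≡ false) adj (count≡0⇒false (∈-allWords y) none)

twoCol-class₀ : (C : Vec Bool n → Bool) → ∀ y → does (twoCol C y Fin.≟ zero) ≡ C y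
twoCol-class₀ C y with C y
... | true  = refl
... | false = refl

twoCol-class₁ : (C : Vec Bool n → Bool) → ∀ y → does (twoCol C y Fin.≟ suc zero) ≡ not (C y)
twoCol-class₁ C y with C y
... | true  = refl
... | false = refl

threeCol-class₀ : (C C₁ : Vec Bool n → Bool) → ∀ y → does (threeCol C C₁ y Fin.≟ zero) ≡ C y
threeCol-class₀ C C₁ y with C y | C₁ y
... | true  | _     = refl
... | false | true  = refl
... | false | false = refl

threeCol-class₁ : (C C₁ : Vec Bool n → Bool) → ∀ y → does (threeCol C C₁ y Fin.≟ suc zero) ≡ not (C y) ∧ C₁ y
threeCol-class₁ C C₁ y with C y | C₁ y
... | true  | _     = refl
... | false | true  = refl
... | false | false = refl

threeCol-class₂ : (C C₁ : Vec Bool n → Bool) → ∀ y →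
                  does (threeCol C C₁ y Fin.≟ suc (suc zero)) ≡ not (C y) ∧ not (C₁ y)
threeCol-class₂ C C₁ y with C y | C₁ y
... | true  | _     = refl
... | false | true  = refl
... | false | false = refl

module FlipSplit {m r : ℕ} (C : Vec Bool (suc m) → Bool) (E : IsEquitable (twoCol C) (S2 r)) where

  neighboursIn-C : ∀ x → neighboursIn x C ≡ S2 r (twoCol C x) zero
  neighboursIn-C x = trans (sym (nbrsIn≡neighboursIn (twoCol C) zero (twoCol-class₀ C) x)) (E x zero)

  neighboursIn-∁C : ∀ x → neighboursIn x (not ∘ C) ≡ S2 r (twoCol C x) (suc zero)
  neighboursIn-∁C x = trans (sym (nbrsIn≡neighboursIn (twoCol C) (suc zero) (twoCol-class₁ C) x)) (E x (suc zero))

  Degrees : Bool → Vec Bool (suc m) → Set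
  Degrees b x = neighboursIn x C ≡ S2 r (if b then zero else suc zero) zero
              × neighboursIn x (not ∘ C) ≡ S2 r (if b then zero else suc zero) (suc zero)

  inside : ∀ {x} → C x ≡ true → neighboursIn x C ≡ 0 × neighboursIn x (not ∘ C) ≡ 3 * r
  inside {x} cx = subst (λ b → Degrees b x) cx (neighboursIn-C x , neighboursIn-∁C x)

  outside : ∀ {x} → C x ≡ false → neighboursIn x C ≡ r × neighboursIn x (not ∘ C) ≡ 2 * r
  outside {x} cx = subst (λ b → Degrees b x) cx (neighboursIn-C x , neighboursIn-∁C x)

  independent : ∀ {x y} → Adjacent x y → C x ≡ true → C y ≡ false
  independent {x} adj cx = neighboursIn≡0⇒false {D = C} {x} adj (proj₁ (inside cx))

  C₁ : Vec Bool (suc m) → Bool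
  C₁ = C ∘ flipHead

  C₁-disjoint : ∀ y → not (C y) ∧ C₁ y ≡ C₁ y
  C₁-disjoint y with C y in cy
  ... | false = refl
  ... | true  = sym (independent (adjacent-flipHead y) cy)

  col : Vec Bool (suc m) → Fin 3
  col = threeCol C C₁

  class₀ : ∀ x → nbrsIn col x zero ≡ neighboursIn x C
  class₀ = nbrsIn≡neighboursIn col zero (threeCol-class₀ C C₁)

  class₁ : ∀ x → nbrsIn col x (suc zero) ≡ neighboursIn (flipHead x) C
  class₁ x = trans (nbrsIn≡neighboursIn col (suc zero) (λ y → trans (threeCol-class₁ C C₁ y) (C₁-disjoint y)) x)
                   (neighboursIn-∘flipHead C x)

  class₁₊₂ : ∀ x → nbrsIn col x (suc zero) + nbrsIn col x (suc (suc zero)) ≡ neighboursIn x (not ∘ C)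
  class₁₊₂ x = sym (trans (neighboursIn-split (not ∘ C) C₁ x)
    (cong₂ _+_ (sym (nbrsIn≡neighboursIn col (suc zero) (threeCol-class₁ C C₁) x))
               (sym (nbrsIn≡neighboursIn col (suc (suc zero)) (threeCol-class₂ C C₁) x))))

  class₂ : ∀ x {a b} → nbrsIn col x (suc zero) ≡ a → neighboursIn x (not ∘ C) ≡ a + b →
           nbrsIn col x (suc (suc zero)) ≡ b
  class₂ x {a} one≡a ∁C≡a+b =
    +-cancelˡ-≡ a _ _ (trans (cong (_+ nbrsIn col x (suc (suc zero))) (sym one≡a)) (trans (class₁₊₂ x) ∁C≡a+b))

  class₁-inside : ∀ {x} → C (flipHead x) ≡ true → nbrsIn col x (suc zero) ≡ 0
  class₁-inside {x} cfx = trans (class₁ x) (proj₁ (inside cfx))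

  class₁-outside : ∀ {x} → C (flipHead x) ≡ false → nbrsIn col x (suc zero) ≡ r
  class₁-outside {x} cfx = trans (class₁ x) (proj₁ (outside cfx))

  equitable : IsEquitable col (S3 r)
  equitable x j with C x in cx
  equitable x zero             | true = trans (class₀ x) (proj₁ (inside cx))
  equitable x (suc zero)       | true = class₁-outside (independent (adjacent-flipHead x) cx)
  equitable x (suc (suc zero)) | true =
    class₂ x (class₁-outside (independent (adjacent-flipHead x) cx)) (proj₂ (inside cx))
  ... | false with C (flipHead x) in cfx
  equitable x zero             | false | true  = trans (class₀ x) (proj₁ (outside cx))
  equitable x (suc zero)       | false | true  = class₁-inside cfx
  equitable x (suc (suc zero)) | false | true  = class₂ x (class₁-inside cfx) (proj₂ (outside cx))
  equitable x zero             | false | false = trans (class₀ x) (proj₁ (outside cx))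
  equitable x (suc zero)       | false | false = class₁-outside cfx
  equitable x (suc (suc zero)) | false | false =
    class₂ x (class₁-outside cfx) (trans (proj₂ (outside cx)) (cong (r +_) (+-identityʳ r)))

S3-zero : ∀ i j → S3 0 i j ≡ 0
S3-zero zero             zero             = refl
S3-zero zero             (suc zero)       = refl
S3-zero zero             (suc (suc zero)) = refl
S3-zero (suc zero)       zero             = refl
S3-zero (suc zero)       (suc zero)       = refl
S3-zero (suc zero)       (suc (suc zero)) = refl
S3-zero (suc (suc zero)) zero             = refl
S3-zero (suc (suc zero)) (suc zero)       = refl
S3-zero (suc (suc zero)) (suc (suc zero)) = refl

lemma1 : (n r : ℕ) → n ≡ 3 * r →
    (C : Vec Bool n → Bool) → IsEquitable (twoCol C) (S2 r) →
    Σ (Vec Bool n → Bool) (λ C1 → IsEquitable (threeCol C C1) (S3 r))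
-- Q_0 has no coordinate to flip; there the hypothesis n ≡ 3 * r forces r = 0.
lemma1 zero    zero    _  C _ = C , λ { [] j → sym (S3-zero (threeCol C C []) j) }
lemma1 zero    (suc r) () C _
lemma1 (suc m) r       _  C E = FlipSplit.C₁ C E , FlipSplit.equitable C E
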